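{- Let $n\ge 4$ and let $\mathcal{S}_n$ be the set of integer solutions, identified up to permutation of coordinates, of $\left(\sum_i x_i\right)^2-\sum_i x_i-4\sum_{1\le i<j\le n}x_ix_j=0$, viewed as a graph with two elements adjacent if (for suitable orderings) they differ in exactly one coordinate. Let $\mathcal{S}_n^+$ and $\mathcal{S}_n^-$ be the sets of elements $\mathbf{x}$ with $\sum_i x_i+1>0$ and $\sum_i x_i+1<0$ respectively. Then each of $\mathcal{S}_n^+$ and $\mathcal{S}_n^-$ has infinitely many connected components.
   Context: Every element of $\mathcal{S}_n$ satisfies $\sum_i x_i+1\neq 0$, and adjacent elements lie in the same one of $\mathcal{S}_n^{\pm}$, so each of $\mathcal{S}_n^{\pm}$ is a union of components of $\mathcal{S}_n$. -}

module Defs where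

open import Data.Nat using (ℕ)
open import Data.Fin using (Fin; toℕ)
open import Data.Fin.Permutation using (Permutation′; _⟨$⟩ʳ_)
open import Data.Integer using (ℤ; _+_; _*_; _-_; _<_; 0ℤ; 1ℤ; +_)
open import Data.Vec.Functional using (Vector; foldr)
open import Data.Nat using (_<?_)
open import Relation.Nullary using (¬_; does)
open import Data.Bool using (if_then_else_)
open import Data.Product using (Σ; ∃; _×_)
open import Data.Sum using (_⊎_)
open import Data.List using (List)
open import Data.List.Relation.Unary.Any using (Any)
open import Relation.Binary.PropositionalEquality using (_≡_; _≢_)
open import Relation.Binary.Construct.Closure.ReflexiveTransitive using (Star)

Pt : ℕ → Set
Pt n = Vector ℤ n

Σ[_] : ∀ {n} → Vector ℤ n → ℤ
Σ[ x ] = foldr _+_ 0ℤ x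

pairSum : ∀ {n} → Pt n → ℤ
pairSum x = Σ[ (λ i → Σ[ (λ j → if does (toℕ i <? toℕ j) then x i * x j else 0ℤ) ] ) ]

IsSol : ∀ {n} → Pt n → Set
IsSol x = (Σ[ x ] * Σ[ x ]) - Σ[ x ] - (+ 4) * pairSum x ≡ 0ℤ

DifferInOne : ∀ {n} → Pt n → Pt n → Set
DifferInOne {n} x y = ∃ λ (i : Fin n) → (x i ≢ y i) × (∀ j → j ≢ i → x j ≡ y j)

-- y is a reordering of x (same element of S_n, which is taken up to permutation)
PermEq : ∀ {n} → Pt n → Pt n → Set
PermEq {n} x y = Σ (Permutation′ n) λ σ → ∀ i → y i ≡ x (σ ⟨$⟩ʳ i)

Adj : ∀ {n} → Pt n → Pt n → Set
Adj {n} x y = Σ (Permutation′ n) λ σ → Σ (Permutation′ n) λ τ →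
  DifferInOne (λ i → x (σ ⟨$⟩ʳ i)) (λ i → y (τ ⟨$⟩ʳ i))

Plus Minus : ∀ {n} → Pt n → Set
Plus x = IsSol x × (0ℤ < Σ[ x ] + 1ℤ)
Minus x = IsSol x × (Σ[ x ] + 1ℤ < 0ℤ)

-- an edge of the subgraph induced on vertex set P (representatives modulo
-- reordering: reordering steps stay at the same vertex)
Step : ∀ {n} → (Pt n → Set) → Pt n → Pt n → Set
Step P x y = P x × P y × (PermEq x y ⊎ Adj x y)

Connected : ∀ {n} → (Pt n → Set) → Pt n → Pt n → Set
Connected P = Star (Step P)

-- the induced subgraph on P has only finitely many connected components:
-- finitely many vertices of P meet every component
FinitelyManyComponents : ∀ {n} → (Pt n → Set) → Set
FinitelyManyComponents {n} P =
  Σ (List (Pt n)) λ L → (Data.List.Relation.Unary.All.All P L) ×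
    (∀ x → P x → Any (λ r → Connected P x r) L)
  where import Data.List.Relation.Unary.All

HasInfinitelyManyComponents : ∀ {n} → (Pt n → Set) → Set
HasInfinitelyManyComponents P = ¬ FinitelyManyComponents P

-- Write s = Σ x_i and q = Σ x_i², so that the equation reads 2q = s(s + 1).  As a quadratic in a
-- single coordinate c it has the second root e = 2s + 1 − 3c, and adjacency in S_n is exactly this
-- Vieta move, up to reordering.  A move changes q by e² − c², which is never 0 because e = −c would
-- give 2c = 2s + 1.  A move that lowers q forces (2s + 1)² < 16c², and as (2s + 1)² = 8q + 1 at most
-- one coordinate can do that: every solution has at most one lower neighbour.  Following lower
-- neighbours therefore shows that the component of a root (a solution with |c| ≤ |e| in every
-- coordinate) has the root as its point of least q.  The roots (−K, K, 2K², 2K², 0, …) in S_n^+ and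
-- (−C, −C, −1 − J, J, 0, …) in S_n^-, with C = 2J² + 2J + 1, have unbounded q, so no finite set of
-- vertices meets every component.

module Submission where

open import Agda.Builtin.FromNat using (Number; fromNat)
open import Data.Nat as ℕ using (ℕ; zero; suc)
import Data.Nat.Literals as ℕ
import Data.Nat.Divisibility as ℕ
import Data.Nat.Properties as ℕ
open import Data.Fin using (Fin; zero; suc; punchIn; punchOut; _≟_)
open import Data.Fin.Properties using (punchInᵢ≢i; punchIn-punchOut)
open import Data.Fin.Permutation using (_⟨$⟩ʳ_; _⟨$⟩ˡ_; _∘ₚ_; id; flip; inverseʳ)
open import Data.Integer hiding (suc; _≟_)
import Data.Integer.Literals as ℤ
open import Data.Integer.Properties hiding (_≟_)
open import Data.Integer.Divisibility.Signed using (divides; ∣⇒∣ᵤ)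
open import Data.Integer.Tactic.RingSolver using (solve; solve-∀)
open import Data.Vec.Functional using (Vector; replicate; updateAt; removeAt) renaming (_∷_ to _∷ᵛ_)
open import Data.Vec.Functional.Properties using (updateAt-updates; updateAt-minimal)
open import Data.List using (List; []; _∷_)
open import Data.List.Relation.Unary.Any as Any using (Any; here; there)
open import Data.Product using (Σ; _×_; _,_; proj₁)
open import Data.Sum as Sum using (_⊎_; inj₁; inj₂; [_,_])
open import Data.Empty using (⊥; ⊥-elim)
open import Data.Unit using (tt)
open import Function.Bundles using (Injection)
open import Function.Properties.Inverse using (Inverse⇒Injection)
open import Relation.Nullary using (yes; no)
open import Relation.Binary.Definitions using (tri<; tri≈; tri>)
open import Relation.Binary.PropositionalEquality hiding ([_])
open import Relation.Binary.Construct.Closure.ReflexiveTransitive using (ε; _◅_)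
open import Algebra.Properties.CommutativeMonoid.Sum +-0-commutativeMonoid
  using (sum-cong-≗; sum-permute; sum-remove; sum-replicate-zero)
open import Algebra.Properties.Semiring.Sum +-*-semiring using (*-distribˡ-sum)

open import Defs

instance
  ℕ-number : Number ℕ
  ℕ-number = ℕ.number
  ℤ-number : Number ℤ
  ℤ-number = ℤ.number

0≤i*i : ∀ i → 0ℤ ≤ i * i
0≤i*i (+ n) = subst (0ℤ ≤_) (pos-* n n) (+≤+ ℕ.z≤n)
0≤i*i -[1+ n ] = +≤+ ℕ.z≤n

0≤i*j : ∀ {i j} → 0ℤ ≤ i → 0ℤ ≤ j → 0ℤ ≤ i * j
0≤i*j (+≤+ {n = m} _) (+≤+ {n = n} _) = subst (0ℤ ≤_) (pos-* m n) (+≤+ ℕ.z≤n)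

0≤αp²+βq² : ∀ α β p q → 0ℤ ≤ + α * (p * p) + + β * (q * q)
0≤αp²+βq² α β p q = +-mono-≤ (0≤i*j {+ α} (+≤+ ℕ.z≤n) (0≤i*i p)) (0≤i*j {+ β} (+≤+ ℕ.z≤n) (0≤i*i q))

0≤αp²+βq²+γ : ∀ α β γ p q → 0ℤ ≤ + α * (p * p) + + β * (q * q) + + γ
0≤αp²+βq²+γ α β γ p q = +-mono-≤ (0≤αp²+βq² α β p q) (+≤+ ℕ.z≤n)

0<αp²+βq²+1+γ : ∀ α β γ p q → 0ℤ < + α * (p * p) + + β * (q * q) + + suc γ
0<αp²+βq²+1+γ α β γ p q = +-mono-≤-< (0≤αp²+βq² α β p q) (+<+ (ℕ.s≤s ℕ.z≤n))

+k<[+[1+k]]² : ∀ k → + k < + suc k * + suc k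
+k<[+[1+k]]² k = subst (+ k <_) (pos-* (suc k) (suc k)) (+<+ (ℕ.m≤m+n (suc k) (k ℕ.* suc k)))

i≤+∣i∣ : ∀ i → i ≤ + ∣ i ∣
i≤+∣i∣ (+ _)    = ≤-refl
i≤+∣i∣ -[1+ _ ] = -≤+

i-j+k≡i⇒k≡j : ∀ i j k → i - j + k ≡ i → k ≡ j
i-j+k≡i⇒k≡j i j k eq = begin
  k                  ≡⟨ solve (i ∷ j ∷ k ∷ []) ⟩
  i - j + k - i + j  ≡⟨ cong (λ l → l - i + j) eq ⟩
  i - i + j          ≡⟨ solve (i ∷ j ∷ []) ⟩
  j                  ∎
  where open ≡-Reasoning

i-j+k<i⇒k<j : ∀ i j k → i - j + k < i → k < j
i-j+k<i⇒k<j i j k lt = begin-strict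
  k                     ≡⟨ solve (i ∷ j ∷ k ∷ []) ⟩
  i - j + k + (j - i)   <⟨ +-monoˡ-< (j - i) lt ⟩
  i + (j - i)           ≡⟨ solve (i ∷ j ∷ []) ⟩
  j                     ∎
  where open ≤-Reasoning

j≤k⇒i≤i-j+k : ∀ i j k → j ≤ k → i ≤ i - j + k
j≤k⇒i≤i-j+k i j k le = begin
  i          ≡⟨ solve (i ∷ j ∷ []) ⟩
  i - j + j  ≤⟨ +-monoʳ-≤ (i - j) le ⟩
  i - j + k  ∎
  where open ≤-Reasoning

i*i≡j*j⇒i≡±j : ∀ i j → i * i ≡ j * j → i ≡ j ⊎ i ≡ - j
i*i≡j*j⇒i≡±j i j eq = Sum.map (i-j≡0⇒i≡j i j) i+j≡0⇒i≡-j (i*j≡0⇒i≡0∨j≡0 (i - j) [i-j][i+j]≡0)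
  where
  i+j≡0⇒i≡-j : i + j ≡ 0ℤ → i ≡ - j
  i+j≡0⇒i≡-j i+j≡0 = i-j≡0⇒i≡j i (- j) (trans (cong (_+_ i) (neg-involutive j)) i+j≡0)
  [i-j][i+j]≡0 : (i - j) * (i + j) ≡ 0ℤ
  [i-j][i+j]≡0 = begin
    (i - j) * (i + j) ≡⟨ solve (i ∷ j ∷ []) ⟩
    i * i - j * j     ≡⟨ i≡j⇒i-j≡0 eq ⟩
    0ℤ                ∎
    where open ≡-Reasoning

2i+1≢2j : ∀ i j → 2 * i + 1 ≢ 2 * j
2i+1≢2j i j eq = ℕ.1+n≢n (ℕ.∣1⇒≡1 (∣⇒∣ᵤ (divides (j - i) 1≡[j-i]*2)))
  where
  1≡[j-i]*2 : 1ℤ ≡ (j - i) * 2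
  1≡[j-i]*2 = begin
    1ℤ                      ≡⟨ solve (i ∷ []) ⟩
    2 * i + 1 - 2 * i       ≡⟨ cong (_- 2 * i) eq ⟩
    2 * j - 2 * i           ≡⟨ solve (i ∷ j ∷ []) ⟩
    (j - i) * 2             ∎
    where open ≡-Reasoning

Σ-differAt : ∀ {n} {u w : Vector ℤ n} (k : Fin n) → (∀ j → j ≢ k → u j ≡ w j) →
  Σ[ w ] ≡ Σ[ u ] - u k + w k
Σ-differAt {suc n} {u} {w} k agree = begin
  Σ[ w ]                               ≡⟨ sum-remove {i = k} w ⟩
  w k + Σ[ removeAt w k ]              ≡⟨ cong (_+_ (w k)) (sum-cong-≗ λ j → sym (agree (punchIn k j) (punchInᵢ≢i k j))) ⟩
  w k + Σ[ removeAt u k ]              ≡⟨ rearrange (w k) (u k) _ ⟩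
  u k + Σ[ removeAt u k ] - u k + w k  ≡⟨ cong (λ s → s - u k + w k) (sum-remove {i = k} u) ⟨
  Σ[ u ] - u k + w k                   ∎
  where
  open ≡-Reasoning
  rearrange : ∀ a b r → a + r ≡ b + r - b + a
  rearrange = solve-∀

Σ-nonneg : ∀ {n} {u : Vector ℤ n} → (∀ i → 0ℤ ≤ u i) → 0ℤ ≤ Σ[ u ]
Σ-nonneg {zero}  _  = ≤-refl
Σ-nonneg {suc n} nn = +-mono-≤ (nn zero) (Σ-nonneg (λ i → nn (suc i)))

term≤Σ : ∀ {n} {u : Vector ℤ n} → (∀ i → 0ℤ ≤ u i) → ∀ i → u i ≤ Σ[ u ]
term≤Σ {suc n} {u} nn i = begin
  u i                      ≤⟨ i≤i+j (u i) _ {{nonNegative (Σ-nonneg (λ j → nn (punchIn i j)))}} ⟩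
  u i + Σ[ removeAt u i ]  ≡⟨ sum-remove {i = i} u ⟨
  Σ[ u ]                   ∎
  where open ≤-Reasoning

twoTerms≤Σ : ∀ {n} {u : Vector ℤ n} → (∀ i → 0ℤ ≤ u i) → ∀ {a b} → a ≢ b → u a + u b ≤ Σ[ u ]
twoTerms≤Σ {suc n} {u} nn {a} {b} a≢b = begin
  u a + u b                           ≡⟨ cong (λ j → u a + u j) (punchIn-punchOut a≢b) ⟨
  u a + removeAt u a (punchOut a≢b)   ≤⟨ +-monoʳ-≤ (u a) (term≤Σ (λ j → nn (punchIn a j)) _) ⟩
  u a + Σ[ removeAt u a ]             ≡⟨ sum-remove {i = a} u ⟨
  Σ[ u ]                              ∎
  where open ≤-Reasoning

sumSq : ∀ {n} → Pt n → ℤ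
sumSq x = Σ[ (λ i → x i * x i) ]

pairSum-suc : ∀ {n} (x : Pt (suc n)) →
  pairSum x ≡ x zero * Σ[ (λ i → x (suc i)) ] + pairSum (λ i → x (suc i))
pairSum-suc {n} x = cong₂ _+_
  (trans (+-identityˡ _) (sym (*-distribˡ-sum (x zero) (λ i → x (suc i)))))
  (sum-cong-≗ {n} (λ i → +-identityˡ _))

2*pairSum≡Σ²-sumSq : ∀ {n} (x : Pt n) → 2 * pairSum x ≡ Σ[ x ] * Σ[ x ] - sumSq x
2*pairSum≡Σ²-sumSq {zero}  x = refl
2*pairSum≡Σ²-sumSq {suc n} x = trans (cong (2 *_) (pairSum-suc x))
  (step (x zero) _ _ _ (2*pairSum≡Σ²-sumSq (λ i → x (suc i))))
  where
  step : ∀ a t p q → 2 * p ≡ t * t - q → 2 * (a * t + p) ≡ (a + t) * (a + t) - (a * a + q)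
  step a t p q 2p≡ = begin
    2 * (a * t + p)                 ≡⟨ solve (a ∷ t ∷ p ∷ []) ⟩
    2 * a * t + 2 * p               ≡⟨ cong (_+_ (2 * a * t)) 2p≡ ⟩
    2 * a * t + (t * t - q)         ≡⟨ solve (a ∷ t ∷ q ∷ []) ⟩
    (a + t) * (a + t) - (a * a + q) ∎
    where open ≡-Reasoning

IsSol′ : ∀ {n} → Pt n → Set
IsSol′ x = 2 * sumSq x ≡ Σ[ x ] * Σ[ x ] + Σ[ x ]

IsSol⇒IsSol′ : ∀ {n} {x : Pt n} → IsSol x → IsSol′ x
IsSol⇒IsSol′ {x = x} sol = i-j≡0⇒i≡j _ _ (begin
  2 * q - (s * s + s)                                   ≡⟨ identity s p q ⟩
  (s * s - s - 4 * p - 0ℤ) + 2 * (2 * p - (s * s - q))  ≡⟨ cong₂ _+_ (i≡j⇒i-j≡0 sol) (cong (2 *_) pairs≡0) ⟩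
  0ℤ                                                    ∎)
  where
  open ≡-Reasoning
  s = Σ[ x ]
  p = pairSum x
  q = sumSq x
  pairs≡0 : 2 * p - (s * s - q) ≡ 0ℤ
  pairs≡0 = i≡j⇒i-j≡0 (2*pairSum≡Σ²-sumSq x)
  identity : ∀ s p q → 2 * q - (s * s + s) ≡ (s * s - s - 4 * p - 0ℤ) + 2 * (2 * p - (s * s - q))
  identity = solve-∀

IsSol′⇒IsSol : ∀ {n} {x : Pt n} → IsSol′ x → IsSol x
IsSol′⇒IsSol {x = x} sol′ = i-j≡0⇒i≡j _ _ (begin
  s * s - s - 4 * p - 0ℤ                             ≡⟨ identity s p q ⟩
  (2 * q - (s * s + s)) - 2 * (2 * p - (s * s - q))  ≡⟨ cong₂ _-_ (i≡j⇒i-j≡0 sol′) (cong (2 *_) pairs≡0) ⟩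
  0ℤ                                                 ∎)
  where
  open ≡-Reasoning
  s = Σ[ x ]
  p = pairSum x
  q = sumSq x
  pairs≡0 : 2 * p - (s * s - q) ≡ 0ℤ
  pairs≡0 = i≡j⇒i-j≡0 (2*pairSum≡Σ²-sumSq x)
  identity : ∀ s p q → s * s - s - 4 * p - 0ℤ ≡ (2 * q - (s * s + s)) - 2 * (2 * p - (s * s - q))
  identity = solve-∀

PermEq-refl : ∀ {n} {x : Pt n} → PermEq x x
PermEq-refl = id , λ _ → refl

PermEq-sym : ∀ {n} {x y : Pt n} → PermEq x y → PermEq y x
PermEq-sym {x = x} {y} (σ , y≡xσ) = flip σ , λ i → trans (cong x (sym (inverseʳ σ))) (sym (y≡xσ (σ ⟨$⟩ˡ i)))

PermEq-trans : ∀ {n} {x y z : Pt n} → PermEq x y → PermEq y z → PermEq x z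
PermEq-trans (σ , y≡xσ) (τ , z≡yτ) = τ ∘ₚ σ , λ i → trans (z≡yτ i) (y≡xσ (τ ⟨$⟩ʳ i))

PermEq-map : ∀ {n} (f : ℤ → ℤ) {x y : Pt n} → PermEq x y → PermEq (λ i → f (x i)) (λ i → f (y i))
PermEq-map f (σ , y≡xσ) = σ , λ i → cong f (y≡xσ i)

PermEq-Σ : ∀ {n} {x y : Pt n} → PermEq x y → Σ[ y ] ≡ Σ[ x ]
PermEq-Σ {x = x} (σ , y≡xσ) = trans (sum-cong-≗ y≡xσ) (sym (sum-permute x σ))

PermEq-sumSq : ∀ {n} {x y : Pt n} → PermEq x y → sumSq y ≡ sumSq x
PermEq-sumSq {x = x} {y} p = PermEq-Σ {x = λ i → x i * x i} (PermEq-map (λ c → c * c) {x} {y} p)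

PermEq-IsSol′ : ∀ {n} {x y : Pt n} → PermEq x y → IsSol′ x → IsSol′ y
PermEq-IsSol′ {x = x} {y} p sol′ = begin
  2 * sumSq y              ≡⟨ cong (2 *_) (PermEq-sumSq {x = x} {y} p) ⟩
  2 * sumSq x              ≡⟨ sol′ ⟩
  Σ[ x ] * Σ[ x ] + Σ[ x ] ≡⟨ cong (λ s → s * s + s) (sym (PermEq-Σ {x = x} {y} p)) ⟩
  Σ[ y ] * Σ[ y ] + Σ[ y ] ∎
  where open ≡-Reasoning

Adj-sym : ∀ {n} {x y : Pt n} → Adj x y → Adj y x
Adj-sym (σ , τ , k , x≢y , agree) = τ , σ , k , (λ eq → x≢y (sym eq)) , λ j j≢k → sym (agree j j≢k)

Adj-respˡ-PermEq : ∀ {n} {x x′ y : Pt n} → PermEq x x′ → Adj x y → Adj x′ y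
Adj-respˡ-PermEq {x = x} {x′} (ρ , x′≡xρ) (σ , τ , k , x≢y , agree) =
  σ ∘ₚ flip ρ , τ , k , (λ eq → x≢y (trans (x≡x′ k) eq)) , λ j j≢k → trans (sym (x≡x′ j)) (agree j j≢k)
  where
  x≡x′ : ∀ j → x (σ ⟨$⟩ʳ j) ≡ x′ (ρ ⟨$⟩ˡ (σ ⟨$⟩ʳ j))
  x≡x′ j = trans (cong x (sym (inverseʳ ρ))) (sym (x′≡xρ _))

-- Vieta moves

_[_]≔_ : ∀ {n} → Pt n → Fin n → ℤ → Pt n
x [ a ]≔ e = updateAt x a (λ _ → e)

Adj⇒PermEq-update : ∀ {n} {x y : Pt n} → Adj x y →
  Σ (Fin n) λ a → Σ ℤ λ e → e ≢ x a × PermEq (x [ a ]≔ e) y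
Adj⇒PermEq-update {x = x} {y} (σ , τ , k , x≢y , agree) =
  σ ⟨$⟩ʳ k , y (τ ⟨$⟩ʳ k) , (λ eq → x≢y (sym eq)) ,
  flip τ ∘ₚ σ , λ i → trans (cong y (sym (inverseʳ τ))) (matches (τ ⟨$⟩ˡ i))
  where
  matches : ∀ j → y (τ ⟨$⟩ʳ j) ≡ (x [ σ ⟨$⟩ʳ k ]≔ y (τ ⟨$⟩ʳ k)) (σ ⟨$⟩ʳ j)
  matches j with j ≟ k
  ... | yes refl = sym (updateAt-updates (σ ⟨$⟩ʳ k) x)
  ... | no j≢k = trans (sym (agree j j≢k))
    (sym (updateAt-minimal _ _ x λ eq → j≢k (Injection.injective (Inverse⇒Injection σ) eq)))

Σ-update : ∀ {n} (x : Pt n) a e → Σ[ x [ a ]≔ e ] ≡ Σ[ x ] - x a + e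
Σ-update x a e = trans (Σ-differAt a λ j j≢a → sym (updateAt-minimal j a x j≢a))
  (cong (_+_ (Σ[ x ] - x a)) (updateAt-updates a x))

sumSq-update : ∀ {n} (x : Pt n) a e → sumSq (x [ a ]≔ e) ≡ sumSq x - x a * x a + e * e
sumSq-update x a e = trans (Σ-differAt a λ j j≢a → sym (cong (λ c → c * c) (updateAt-minimal j a x j≢a)))
  (cong (λ c → sumSq x - x a * x a + c * c) (updateAt-updates a x))

conj : ∀ {n} → Pt n → Fin n → ℤ
conj x a = 2 * Σ[ x ] + 1 - 3 * x a

move : ∀ {n} → Pt n → Fin n → Pt n
move x a = x [ a ]≔ conj x a

other-root : ∀ {s q c e} → 2 * q ≡ s * s + s →
  2 * (q - c * c + e * e) ≡ (s - c + e) * (s - c + e) + (s - c + e) → e ≢ c → e ≡ 2 * s + 1 - 3 * c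
other-root {s} {q} {c} {e} sol sol′ e≢c =
  [ (λ e-c≡0 → ⊥-elim (e≢c (i-j≡0⇒i≡j e c e-c≡0))) , i-j≡0⇒i≡j e (2 * s + 1 - 3 * c) ]
  (i*j≡0⇒i≡0∨j≡0 (e - c) product≡0)
  where
  open ≡-Reasoning
  identity : ∀ s q c e → (e - c) * (e - (2 * s + 1 - 3 * c)) ≡
    (2 * (q - c * c + e * e) - ((s - c + e) * (s - c + e) + (s - c + e))) - (2 * q - (s * s + s))
  identity = solve-∀
  product≡0 : (e - c) * (e - (2 * s + 1 - 3 * c)) ≡ 0ℤ
  product≡0 = begin
    (e - c) * (e - (2 * s + 1 - 3 * c))
      ≡⟨ identity s q c e ⟩
    (2 * (q - c * c + e * e) - ((s - c + e) * (s - c + e) + (s - c + e))) - (2 * q - (s * s + s))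
      ≡⟨ cong₂ _-_ (i≡j⇒i-j≡0 sol′) (i≡j⇒i-j≡0 sol) ⟩
    0ℤ ∎

update-conj : ∀ {n} {x : Pt n} {a e} → IsSol′ x → IsSol′ (x [ a ]≔ e) → e ≢ x a → e ≡ conj x a
update-conj {x = x} {a} {e} sol sol′ = other-root {Σ[ x ]} {sumSq x} {x a} {e} sol (begin
  2 * (sumSq x - x a * x a + e * e)
    ≡⟨ cong (2 *_) (sumSq-update x a e) ⟨
  2 * sumSq (x [ a ]≔ e)
    ≡⟨ sol′ ⟩
  Σ[ x [ a ]≔ e ] * Σ[ x [ a ]≔ e ] + Σ[ x [ a ]≔ e ]
    ≡⟨ cong (λ s → s * s + s) (Σ-update x a e) ⟩
  (Σ[ x ] - x a + e) * (Σ[ x ] - x a + e) + (Σ[ x ] - x a + e) ∎)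
  where open ≡-Reasoning

Adj⇒PermEq-move : ∀ {n} {x y : Pt n} → IsSol x → IsSol y → Adj x y →
  Σ (Fin n) λ a → conj x a ≢ x a × PermEq (move x a) y
Adj⇒PermEq-move {x = x} {y} solx soly adj with Adj⇒PermEq-update {x = x} {y} adj
... | a , e , e≢xa , p = a , subst (_≢ x a) e≡conj e≢xa , subst (λ e → PermEq (x [ a ]≔ e) _) e≡conj p
  where
  e≡conj : e ≡ conj x a
  e≡conj = update-conj {x = x} (IsSol⇒IsSol′ {x = x} solx)
    (PermEq-IsSol′ {x = y} (PermEq-sym {x = x [ a ]≔ e} {y} p) (IsSol⇒IsSol′ {x = y} soly)) e≢xa

sumSq-move : ∀ {n} (x : Pt n) a → sumSq (move x a) ≡ sumSq x - x a * x a + conj x a * conj x a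
sumSq-move x a = sumSq-update x a (conj x a)

Adj⇒sumSq : ∀ {n} {x y : Pt n} → IsSol x → IsSol y → Adj x y →
  Σ (Fin n) λ a → conj x a ≢ x a × sumSq y ≡ sumSq x - x a * x a + conj x a * conj x a
Adj⇒sumSq {x = x} {y} solx soly adj =
  let a , conj≢ , p = Adj⇒PermEq-move {x = x} {y} solx soly adj
  in a , conj≢ , trans (PermEq-sumSq {x = move x a} {y} p) (sumSq-move x a)

-- The sum of squares along edges

conj²≢ : ∀ s c → 2 * s + 1 - 3 * c ≢ c → (2 * s + 1 - 3 * c) * (2 * s + 1 - 3 * c) ≢ c * c
conj²≢ s c e≢c e²≡c² = [ e≢c , (λ e≡-c → 2i+1≢2j s c (odd≡even e≡-c)) ] (i*i≡j*j⇒i≡±j _ c e²≡c²)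
  where
  odd≡even : 2 * s + 1 - 3 * c ≡ - c → 2 * s + 1 ≡ 2 * c
  odd≡even e≡-c = begin
    2 * s + 1                   ≡⟨ solve (s ∷ c ∷ []) ⟩
    (2 * s + 1 - 3 * c) + 3 * c ≡⟨ cong (_+ 3 * c) e≡-c ⟩
    - c + 3 * c                 ≡⟨ solve (c ∷ []) ⟩
    2 * c                       ∎
    where open ≡-Reasoning

Adj⇒sumSq≢ : ∀ {n} {x y : Pt n} → IsSol x → IsSol y → Adj x y → sumSq y ≢ sumSq x
Adj⇒sumSq≢ {x = x} {y} solx soly adj eq =
  let a , conj≢ , sumSq-y = Adj⇒sumSq {x = x} {y} solx soly adj
  in conj²≢ Σ[ x ] (x a) conj≢
       (i-j+k≡i⇒k≡j (sumSq x) (x a * x a) (conj x a * conj x a) (trans (sym sumSq-y) eq))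

[t-3c]²<c²⇒t²<16c² : ∀ t c → (t - 3 * c) * (t - 3 * c) < c * c → t * t < 16 * (c * c)
[t-3c]²<c²⇒t²<16c² t c e²<c² = begin-strict
  t * t                                                       ≤⟨ i≤i+j (t * t) _ {{nonNegative 0≤3d²}} ⟩
  t * t + 3 * ((c - (t - 3 * c)) * (c - (t - 3 * c)))        ≡⟨ solve (t ∷ c ∷ []) ⟩
  12 * (c * c) + 4 * ((t - 3 * c) * (t - 3 * c))              <⟨ +-monoʳ-< (12 * (c * c)) (*-monoˡ-<-pos 4 e²<c²) ⟩
  12 * (c * c) + 4 * (c * c)                                  ≡⟨ solve (c ∷ []) ⟩
  16 * (c * c)                                                ∎
  where
  open ≤-Reasoning
  0≤3d² : 0ℤ ≤ 3 * ((c - (t - 3 * c)) * (c - (t - 3 * c)))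
  0≤3d² = *-monoˡ-≤-nonNeg 3 (0≤i*i (c - (t - 3 * c)))

two-descents-impossible : ∀ {s q c c′} → 2 * q ≡ s * s + s → c * c + c′ * c′ ≤ q →
  (2 * s + 1) * (2 * s + 1) < 16 * (c * c) → (2 * s + 1) * (2 * s + 1) < 16 * (c′ * c′) → ⊥
two-descents-impossible {s} {q} {c} {c′} sol two≤q t²<16c² t²<16c′² = <-irrefl refl (begin-strict
  2 * ((2 * s + 1) * (2 * s + 1))                        ≡⟨ solve (s ∷ []) ⟩
  (2 * s + 1) * (2 * s + 1) + (2 * s + 1) * (2 * s + 1)  <⟨ +-mono-< t²<16c² t²<16c′² ⟩
  16 * (c * c) + 16 * (c′ * c′)                          ≡⟨ solve (c ∷ c′ ∷ []) ⟨
  16 * (c * c + c′ * c′)                                 ≤⟨ *-monoˡ-≤-nonNeg 16 two≤q ⟩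
  16 * q                                                 ≤⟨ i≤i+j (16 * q) 2 ⟩
  16 * q + 2                                             ≡⟨ solve (q ∷ []) ⟩
  8 * (2 * q) + 2                                        ≡⟨ cong (λ l → 8 * l + 2) sol ⟩
  8 * (s * s + s) + 2                                    ≡⟨ solve (s ∷ []) ⟩
  2 * ((2 * s + 1) * (2 * s + 1))                        ∎)
  where open ≤-Reasoning

lower-move⇒[2s+1]²<16c² : ∀ {n} {x w : Pt n} a → PermEq (move x a) w → sumSq w < sumSq x →
  (2 * Σ[ x ] + 1) * (2 * Σ[ x ] + 1) < 16 * (x a * x a)
lower-move⇒[2s+1]²<16c² {x = x} {w} a p w<x = [t-3c]²<c²⇒t²<16c² (2 * Σ[ x ] + 1) (x a)
  (i-j+k<i⇒k<j (sumSq x) (x a * x a) (conj x a * conj x a)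
    (subst (_< sumSq x) (trans (PermEq-sumSq {x = move x a} {w} p) (sumSq-move x a)) w<x))

lower-neighbour-unique : ∀ {n} {x y z : Pt n} → IsSol x → IsSol y → IsSol z → Adj x y → Adj x z →
  sumSq y < sumSq x → sumSq z < sumSq x → PermEq y z
lower-neighbour-unique {x = x} {y} {z} solx soly solz x~y x~z y<x z<x =
  let a , _ , y≈ = Adj⇒PermEq-move {x = x} {y} solx soly x~y
      b , _ , z≈ = Adj⇒PermEq-move {x = x} {z} solx solz x~z
  in same-move a b y≈ z≈ (lower-move⇒[2s+1]²<16c² a y≈ y<x) (lower-move⇒[2s+1]²<16c² b z≈ z<x)
  where
  same-move : ∀ a b → PermEq (move x a) y → PermEq (move x b) z →
    (2 * Σ[ x ] + 1) * (2 * Σ[ x ] + 1) < 16 * (x a * x a) →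
    (2 * Σ[ x ] + 1) * (2 * Σ[ x ] + 1) < 16 * (x b * x b) → PermEq y z
  same-move a b y≈ z≈ a-lower b-lower with a ≟ b
  ... | yes refl = PermEq-trans {x = y} {move x a} {z} (PermEq-sym {x = move x a} {y} y≈) z≈
  ... | no a≢b = ⊥-elim (two-descents-impossible {Σ[ x ]} {sumSq x} {x a} {x b} (IsSol⇒IsSol′ {x = x} solx)
                   (twoTerms≤Σ {u = λ i → x i * x i} (λ i → 0≤i*i (x i)) a≢b) a-lower b-lower)

IsRoot : ∀ {n} → Pt n → Set
IsRoot r = ∀ a → r a * r a ≤ conj r a * conj r a

IsRoot⇒sumSq-minimal : ∀ {n} {r y : Pt n} → IsSol r → IsRoot r → IsSol y → Adj r y → sumSq r ≤ sumSq y
IsRoot⇒sumSq-minimal {r = r} {y} solr root soly r~y =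
  let a , _ , sumSq-y = Adj⇒sumSq {x = r} {y} solr soly r~y
  in subst (sumSq r ≤_) (sym sumSq-y)
       (j≤k⇒i≤i-j+k (sumSq r) (r a * r a) (conj r a * conj r a) (root a))

-- If every vertex has at most one lower neighbour and no edge is level, then the
-- component of a local minimum r consists of the vertices whose descending path
-- ends at r, so h attains its minimum over that component at r.
module TreeDescent {n : ℕ} (P : Pt n → Set) (h : Pt n → ℤ)
  (h-PermEq : ∀ {x y} → PermEq x y → h y ≡ h x)
  (h-Adj : ∀ {x y} → P x → P y → Adj x y → h y ≢ h x)
  (lower-unique : ∀ {x y z} → P x → P y → P z → Adj x y → Adj x z → h y < h x → h z < h x → PermEq y z)
  where

  IsLocalMin : Pt n → Set
  IsLocalMin r = ∀ {y} → P y → Adj r y → h r ≤ h y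

  data DescendsTo (r : Pt n) : Pt n → Set where
    here : ∀ {x} → PermEq r x → DescendsTo r x
    down : ∀ {x x′} → P x → P x′ → Adj x x′ → h x′ < h x → DescendsTo r x′ → DescendsTo r x

  DescendsTo-PermEq : ∀ {r x x′} → P x′ → DescendsTo r x → PermEq x x′ → DescendsTo r x′
  DescendsTo-PermEq {r} {x} {x′} _ (here r≈x) x≈x′ = here (PermEq-trans {x = r} {x} {x′} r≈x x≈x′)
  DescendsTo-PermEq {r} {x} {x′} Px′ (down {x′ = y} Px Py x~y y<x r⇣y) x≈x′ =
    down Px′ Py (Adj-respˡ-PermEq {x = x} {x′} {y} x≈x′ x~y) (subst (h y <_) (sym (h-PermEq x≈x′)) y<x) r⇣y

  DescendsTo-Step : ∀ {r x y} → IsLocalMin r → DescendsTo r x → Step P x y → DescendsTo r y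
  DescendsTo-Step _ r⇣x (_ , Py , inj₁ x≈y) = DescendsTo-PermEq Py r⇣x x≈y
  DescendsTo-Step {r} {x} {y} min r⇣x (Px , Py , inj₂ x~y) with <-cmp (h y) (h x)
  ... | tri≈ _ y≡x _ = ⊥-elim (h-Adj Px Py x~y y≡x)
  ... | tri> _ _ x<y = down Py Px (Adj-sym {x = x} {y} x~y) x<y r⇣x
  ... | tri< y<x _ _ with r⇣x
  ...   | here r≈x = ⊥-elim (≤⇒≯ (min Py (Adj-respˡ-PermEq {x = x} {r} {y} (PermEq-sym {x = r} {x} r≈x) x~y))
                                   (subst (h y <_) (h-PermEq r≈x) y<x))
  ...   | down _ Px′ x~x′ x′<x r⇣x′ = DescendsTo-PermEq Py r⇣x′ (lower-unique Px Px′ Py x~x′ x~y x′<x y<x)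

  DescendsTo-Connected : ∀ {r x y} → IsLocalMin r → DescendsTo r x → Connected P x y → DescendsTo r y
  DescendsTo-Connected _   r⇣x ε        = r⇣x
  DescendsTo-Connected min r⇣x (s ◅ ss) = DescendsTo-Connected min (DescendsTo-Step min r⇣x s) ss

  DescendsTo⇒≤ : ∀ {r x} → DescendsTo r x → h r ≤ h x
  DescendsTo⇒≤ (here r≈x)            = ≤-reflexive (sym (h-PermEq r≈x))
  DescendsTo⇒≤ (down _ _ _ y<x r⇣y) = ≤-trans (DescendsTo⇒≤ r⇣y) (<⇒≤ y<x)

  maxHeight : List (Pt n) → ℤ
  maxHeight []      = 0ℤ
  maxHeight (l ∷ L) = h l ⊔ maxHeight L

  ≤-maxHeight : ∀ {m L} → Any (λ l → m ≤ h l) L → m ≤ maxHeight L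
  ≤-maxHeight {L = l ∷ L} (here m≤l)  = ≤-trans m≤l (i≤i⊔j (h l) (maxHeight L))
  ≤-maxHeight {L = l ∷ L} (there m≤L) = ≤-trans (≤-maxHeight m≤L) (i≤j⊔i (h l) (maxHeight L))

  infinitelyManyComponents : (∀ (k : ℕ) → Σ (Pt n) λ r → P r × IsLocalMin r × + k < h r) →
    HasInfinitelyManyComponents P
  infinitelyManyComponents roots (L , _ , cover) with roots ∣ maxHeight L ∣
  ... | r , Pr , min , big = <-irrefl refl (begin-strict
    h r                ≤⟨ ≤-maxHeight (Any.map (λ r~l → DescendsTo⇒≤ (r⇣ r~l)) (cover r Pr)) ⟩
    maxHeight L        ≤⟨ i≤+∣i∣ (maxHeight L) ⟩
    + ∣ maxHeight L ∣  <⟨ big ⟩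
    h r                ∎)
    where
    open ≤-Reasoning
    r⇣ : ∀ {l} → Connected P r l → DescendsTo r l
    r⇣ = DescendsTo-Connected min (here PermEq-refl)

-- Two families of roots

-- In the families below, u and v are ±(conj − c) and ±(conj + c), written as sums of squares.
conj²-certificate : ∀ {n} {x : Pt n} {s} → Σ[ x ] ≡ s → ∀ a {c} → x a ≡ c → ∀ u v → 0ℤ ≤ u → 0ℤ ≤ v →
  (2 * s + 1 - 3 * c) * (2 * s + 1 - 3 * c) ≡ c * c + u * v → x a * x a ≤ conj x a * conj x a
conj²-certificate {x = x} refl a refl u v 0≤u 0≤v e²≡ = begin
  x a * x a             ≤⟨ i≤i+j (x a * x a) (u * v) {{nonNegative (0≤i*j {u} {v} 0≤u 0≤v)}} ⟩
  x a * x a + u * v     ≡⟨ e²≡ ⟨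
  conj x a * conj x a   ∎
  where open ≤-Reasoning

pad : ∀ {m} → ℤ → ℤ → ℤ → ℤ → Pt (4 ℕ.+ m)
pad a b c d = a ∷ᵛ b ∷ᵛ c ∷ᵛ d ∷ᵛ replicate _ 0ℤ

Σ-pad : ∀ {m} a b c d → Σ[ pad {m} a b c d ] ≡ a + b + c + d
Σ-pad {m} a b c d = begin
  a + (b + (c + (d + Σ[ replicate m 0ℤ ]))) ≡⟨ cong (λ z → a + (b + (c + (d + z)))) (sum-replicate-zero m) ⟩
  a + (b + (c + (d + 0ℤ)))                  ≡⟨ solve (a ∷ b ∷ c ∷ d ∷ []) ⟩
  a + b + c + d                             ∎
  where open ≡-Reasoning

sumSq-pad : ∀ {m} a b c d → sumSq (pad {m} a b c d) ≡ a * a + b * b + c * c + d * d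
sumSq-pad {m} a b c d = Σ-pad {m} (a * a) (b * b) (c * c) (d * d)

pad-IsSol : ∀ {m} a b c d → let s = a + b + c + d in
  2 * (a * a + b * b + c * c + d * d) ≡ s * s + s → IsSol (pad {m} a b c d)
pad-IsSol {m} a b c d eq = IsSol′⇒IsSol {x = pad {m} a b c d} (begin
  2 * sumSq (pad {m} a b c d)              ≡⟨ cong (2 *_) (sumSq-pad {m} a b c d) ⟩
  2 * (a * a + b * b + c * c + d * d)      ≡⟨ eq ⟩
  s * s + s                                ≡⟨ cong (λ z → z * z + z) (Σ-pad {m} a b c d) ⟨
  Σ[ pad {m} a b c d ] * Σ[ pad {m} a b c d ] + Σ[ pad {m} a b c d ] ∎)
  where
  open ≡-Reasoning
  s = a + b + c + d

module PlusFamily (m : ℕ) (K : ℤ) where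

  point : Pt (4 ℕ.+ m)
  point = pad (- K) K (2 * (K * K)) (2 * (K * K))

  Σ-point : Σ[ point ] ≡ 4 * (K * K)
  Σ-point = trans (Σ-pad {m} (- K) K (2 * (K * K)) (2 * (K * K))) (solve (K ∷ []))

  isSol : IsSol point
  isSol = pad-IsSol {m} (- K) K (2 * (K * K)) (2 * (K * K)) (solve (K ∷ []))

  plus : Plus point
  plus = isSol , (begin-strict
    0ℤ                             <⟨ 0<αp²+βq²+1+γ 4 0 0 K K ⟩
    4 * (K * K) + 0 * (K * K) + 1  ≡⟨ solve (K ∷ []) ⟩
    4 * (K * K) + 1                ≡⟨ cong (_+ 1ℤ) Σ-point ⟨
    Σ[ point ] + 1ℤ                ∎)
    where open ≤-Reasoning

  root : IsRoot point
  root zero = conj²-certificate {x = point} Σ-point zero {c = - K} refl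
    (4 * (K * K) + 1 * ((2 * K + 1) * (2 * K + 1)) + 0) (7 * (K * K) + 1 * ((K + 1) * (K + 1)) + 0)
    (0≤αp²+βq²+γ 4 1 0 K (2 * K + 1)) (0≤αp²+βq²+γ 7 1 0 K (K + 1)) (solve (K ∷ []))
  root (suc zero) = conj²-certificate {x = point} Σ-point (suc zero) {K} refl
    (4 * (K * K) + 1 * ((2 * K - 1) * (2 * K - 1)) + 0) (7 * (K * K) + 1 * ((K - 1) * (K - 1)) + 0)
    (0≤αp²+βq²+γ 4 1 0 K (2 * K - 1)) (0≤αp²+βq²+γ 7 1 0 K (K - 1)) (solve (K ∷ []))
  root (suc (suc zero)) = conj²-certificate {x = point} Σ-point (suc (suc zero)) {2 * (K * K)} refl
    (0 * (K * K) + 0 * (K * K) + 1) (4 * (K * K) + 0 * (K * K) + 1)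
    (0≤αp²+βq²+γ 0 0 1 K K) (0≤αp²+βq²+γ 4 0 1 K K) (solve (K ∷ []))
  root (suc (suc (suc zero))) = conj²-certificate {x = point} Σ-point (suc (suc (suc zero))) {2 * (K * K)} refl
    (0 * (K * K) + 0 * (K * K) + 1) (4 * (K * K) + 0 * (K * K) + 1)
    (0≤αp²+βq²+γ 0 0 1 K K) (0≤αp²+βq²+γ 4 0 1 K K) (solve (K ∷ []))
  root (suc (suc (suc (suc i)))) = conj²-certificate {x = point} Σ-point (suc (suc (suc (suc i)))) {0ℤ} refl
    (8 * (K * K) + 0 * (K * K) + 1) (8 * (K * K) + 0 * (K * K) + 1)
    (0≤αp²+βq²+γ 8 0 1 K K) (0≤αp²+βq²+γ 8 0 1 K K) (solve (K ∷ []))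

  K*K≤sumSq : K * K ≤ sumSq point
  K*K≤sumSq = term≤Σ {u = λ i → point i * point i} (λ i → 0≤i*i (point i)) (suc zero)

module MinusFamily (m : ℕ) (J : ℤ) where

  point : Pt (4 ℕ.+ m)
  point = pad (- (2 * (J * J) + 2 * J + 1)) (- (2 * (J * J) + 2 * J + 1)) (- (1 + J)) J

  Σ-point : Σ[ point ] ≡ - (4 * (J * J) + 4 * J + 3)
  Σ-point = trans (Σ-pad {m} (- (2 * (J * J) + 2 * J + 1)) (- (2 * (J * J) + 2 * J + 1)) (- (1 + J)) J)
    (solve (J ∷ []))

  isSol : IsSol point
  isSol = pad-IsSol {m} (- (2 * (J * J) + 2 * J + 1)) (- (2 * (J * J) + 2 * J + 1)) (- (1 + J)) J
    (solve (J ∷ []))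

  minus : Minus point
  minus = isSol , (begin-strict
    Σ[ point ] + 1ℤ                                       ≡⟨ cong (_+ 1ℤ) Σ-point ⟩
    - (4 * (J * J) + 4 * J + 3) + 1                       ≡⟨ solve (J ∷ []) ⟩
    - (1 * ((2 * J + 1) * (2 * J + 1)) + 0 * (J * J) + 1) <⟨ neg-mono-< (0<αp²+βq²+1+γ 1 0 0 (2 * J + 1) J) ⟩
    0ℤ                                                    ∎)
    where open ≤-Reasoning

  root : IsRoot point
  root zero = conj²-certificate {x = point} Σ-point zero {c = - (2 * (J * J) + 2 * J + 1)} refl
    (0 * (J * J) + 0 * (J * J) + 1) (1 * ((2 * J + 1) * (2 * J + 1)) + 0 * (J * J) + 2)
    (0≤αp²+βq²+γ 0 0 1 J J) (0≤αp²+βq²+γ 1 0 2 (2 * J + 1) J) (solve (J ∷ []))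
  root (suc zero) = conj²-certificate {x = point} Σ-point (suc zero) {c = - (2 * (J * J) + 2 * J + 1)} refl
    (0 * (J * J) + 0 * (J * J) + 1) (1 * ((2 * J + 1) * (2 * J + 1)) + 0 * (J * J) + 2)
    (0≤αp²+βq²+γ 0 0 1 J J) (0≤αp²+βq²+γ 1 0 2 (2 * J + 1) J) (solve (J ∷ []))
  root (suc (suc zero)) = conj²-certificate {x = point} Σ-point (suc (suc zero)) {c = - (1 + J)} refl
    (4 * (J * J) + 1 * ((2 * J + 1) * (2 * J + 1)) + 0) (5 * (J * J) + 3 * ((J + 1) * (J + 1)) + 0)
    (0≤αp²+βq²+γ 4 1 0 J (2 * J + 1)) (0≤αp²+βq²+γ 5 3 0 J (J + 1)) (solve (J ∷ []))
  root (suc (suc (suc zero))) = conj²-certificate {x = point} Σ-point (suc (suc (suc zero))) {J} refl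
    (1 * ((2 * J + 1) * (2 * J + 1)) + 1 * ((2 * J + 2) * (2 * J + 2)) + 0) (3 * (J * J) + 5 * ((J + 1) * (J + 1)) + 0)
    (0≤αp²+βq²+γ 1 1 0 (2 * J + 1) (2 * J + 2)) (0≤αp²+βq²+γ 3 5 0 J (J + 1)) (solve (J ∷ []))
  root (suc (suc (suc (suc i)))) = conj²-certificate {x = point} Σ-point (suc (suc (suc (suc i)))) {0ℤ} refl
    (2 * ((2 * J + 1) * (2 * J + 1)) + 0 * (J * J) + 3) (2 * ((2 * J + 1) * (2 * J + 1)) + 0 * (J * J) + 3)
    (0≤αp²+βq²+γ 2 0 3 (2 * J + 1) J) (0≤αp²+βq²+γ 2 0 3 (2 * J + 1) J) (solve (J ∷ []))

  J*J≤sumSq : J * J ≤ sumSq point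
  J*J≤sumSq = term≤Σ {u = λ i → point i * point i} (λ i → 0≤i*i (point i)) (suc (suc (suc zero)))

infinitelyManyComponents : ∀ {n} (P : Pt n → Set) → (∀ {x} → P x → IsSol x) →
  (∀ (k : ℕ) → Σ (Pt n) λ r → P r × IsRoot r × + k < sumSq r) → HasInfinitelyManyComponents P
infinitelyManyComponents P P⇒IsSol roots = Descent.infinitelyManyComponents λ k →
  let r , Pr , root , tall = roots k
  in r , Pr , (λ {y} Py → IsRoot⇒sumSq-minimal {r = r} {y} (P⇒IsSol Pr) root (P⇒IsSol Py)) , tall
  where
  module Descent = TreeDescent P sumSq
    (λ {x} {y} → PermEq-sumSq {x = x} {y})
    (λ {x} {y} Px Py → Adj⇒sumSq≢ {x = x} {y} (P⇒IsSol Px) (P⇒IsSol Py))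
    (λ {x} {y} {z} Px Py Pz →
      lower-neighbour-unique {x = x} {y} {z} (P⇒IsSol Px) (P⇒IsSol Py) (P⇒IsSol Pz))

theorem4p8 : (n : ℕ) → 4 ℕ.≤ n →
    HasInfinitelyManyComponents (Plus {n}) × HasInfinitelyManyComponents (Minus {n})
theorem4p8 .(4 ℕ.+ m) (ℕ.s≤s (ℕ.s≤s (ℕ.s≤s (ℕ.s≤s {n = m} _)))) =
  infinitelyManyComponents Plus proj₁ plusRoots , infinitelyManyComponents Minus proj₁ minusRoots
  where
  plusRoots : ∀ k → Σ (Pt (4 ℕ.+ m)) λ r → Plus r × IsRoot r × + k < sumSq r
  plusRoots k = point , plus , root , <-≤-trans (+k<[+[1+k]]² k) K*K≤sumSq
    where open PlusFamily m (+ suc k)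
  minusRoots : ∀ k → Σ (Pt (4 ℕ.+ m)) λ r → Minus r × IsRoot r × + k < sumSq r
  minusRoots k = point , minus , root , <-≤-trans (+k<[+[1+k]]² k) J*J≤sumSq
    where open MinusFamily m (+ suc k)
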